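{- There exists an absolute constant $c$ such that for every finite graph $G$ with maximum degree $\Delta(G)\ge 1$ and every positive integer $b$, $\chi_{P,b}(G)\le c\, b\,\Delta(G)$.
   Context: All graphs are finite and simple. For positive integers $k,b$, the $b$-fold $k$-painting game on a graph $G$ is played by Lister and Painter: in round $i$, Lister presents a non-empty set $V_i\subseteq V(G)$ such that each $v\in V_i$ is contained in fewer than $b$ of the sets $X_j$, $j\le i-1$; Painter then chooses an independent set $X_i\subseteq V_i$. If at the end of some round some vertex $v$ is contained in $k$ of the sets $V_i$ but in fewer than $b$ of the sets $X_i$, Lister wins; otherwise at some round every vertex is contained in $b$ of the sets $X_i$ and Painter wins. $G$ is $b$-fold $k$-paintable if Painter has a winning strategy, and the $b$-paint number $\chi_{P,b}(G)$ is the least $k$ such that $G$ is $b$-fold $k$-paintable. $\Delta(G)$ denotes the maximum degree of $G$. -}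

module Defs where

open import Data.Nat using (ℕ; zero; suc; _+_; _<_; _≤_; _⊔_)
open import Data.Bool using (Bool; true; false; if_then_else_)
open import Data.Fin using (Fin)
open import Data.Fin.Subset using (Subset; _∈_; _⊆_; Nonempty; ∣_∣)
open import Data.Vec using (lookup; tabulate)
open import Data.List using (List; foldr; map; allFin)
open import Data.Product using (Σ; _×_)
open import Relation.Binary.PropositionalEquality using (_≡_)

record Graph (n : ℕ) : Set where
  field
    adj   : Fin n → Fin n → Bool
    sym   : ∀ u v → adj u v ≡ adj v u
    irref : ∀ v → adj v v ≡ false
open Graph public

nbhd : ∀ {n} → Graph n → Fin n → Subset n
nbhd G v = tabulate (adj G v)

degree : ∀ {n} → Graph n → Fin n → ℕ
degree G v = ∣ nbhd G v ∣

maxDegree : ∀ {n} → Graph n → ℕ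
maxDegree {n} G = foldr _⊔_ 0 (map (degree G) (allFin n))

Independent : ∀ {n} → Graph n → Subset n → Set
Independent G X = ∀ u v → u ∈ X → v ∈ X → adj G u v ≡ false

ind : ∀ {n} → Subset n → Fin n → ℕ
ind S v = if lookup S v then 1 else 0

-- Game state: l v = number of sets V_i containing v so far,
--             x v = number of sets X_i containing v so far.
data PainterWins {n : ℕ} (G : Graph n) (b k : ℕ) (l x : Fin n → ℕ) : Set where
  done : (∀ v → b ≤ x v) → PainterWins G b k l x
  step : (∀ (V : Subset n) → Nonempty V → (∀ v → v ∈ V → x v < b) →
            Σ (Subset n) λ X → X ⊆ V × Independent G X ×
              -- Lister has not won at the end of this round
              (∀ v → k ≤ l v + ind V v → b ≤ x v + ind X v) ×
              PainterWins G b k (λ v → l v + ind V v) (λ v → x v + ind X v))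
         → PainterWins G b k l x

Paintable : ∀ {n} → ℕ → ℕ → Graph n → Set
Paintable b k G = PainterWins G b k (λ _ → 0) (λ _ → 0)

module Submission where

-- Painter's strategy: in every round colour a maximal independent subset X
-- of the presented set V.  Then each v ∈ V is coloured or has a coloured
-- neighbour, so the number of colours "seen" on the closed neighbourhood of
-- v grows at least as fast as the number of times v has been listed.  Since
-- no vertex receives more than b colours, v sees at most b + b·Δ(G)
-- colours without itself having b of them; hence with k = b + b·Δ(G)
-- Lister never wins.  Every round colours some vertex that still needs a
-- colour, so the total remaining demand Σᵥ (b ∸ xᵥ) strictly decreases and
-- the game ends.  As b + b·Δ ≤ 2·b·Δ for Δ ≥ 1, the constant c = 2 works.

open import Defs
open import Data.Nat using (ℕ; _*_; _≤_)
open import Data.Product using (Σ; _×_)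
open import Data.Nat using (zero; suc; _+_; _∸_; _<_; _⊔_; z≤n; s≤s)
open import Data.Nat.Properties
open import Data.Bool using (true; false)
import Data.Bool.Properties as Bool
open import Data.Fin using (Fin) renaming (zero to fzero; suc to fsuc)
open import Data.Fin.Properties using (any?)
open import Data.Fin.Subset using (Subset; _∈_; _∉_; _⊆_; Nonempty; ∣_∣; _∪_; ⁅_⁆)
  renaming (⊥ to ∅)
open import Data.Fin.Subset.Properties
  using (_∈?_; ∉⊥; ⊥⊆; x∈⁅x⁆; x∈⁅y⁆⇒x≡y; x∈p∪q⁻; x∈p∪q⁺; q⊆p∪q)
open import Data.Vec using ([]; _∷_; lookup)
open import Data.Vec.Properties using (lookup∘tabulate; []=⇒lookup; lookup⇒[]=)
open import Data.List using (List; []; _∷_; foldr; map; allFin)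
import Data.List.Membership.Propositional as List
open import Data.List.Membership.Propositional.Properties using (∈-allFin)
open import Data.List.Relation.Unary.Any using (here; there)
open import Data.Product using (_,_; ∃-syntax; Σ-syntax)
open import Data.Sum using (_⊎_; inj₁; inj₂)
open import Relation.Nullary using (Dec; yes; no; ¬_; contradiction)
open import Relation.Nullary.Decidable using (_×-dec_; _⊎-dec_)
open import Relation.Binary.PropositionalEquality
  using (_≡_; refl; trans; cong) renaming (sym to ≡-sym)

∑ : ∀ {n} → (Fin n → ℕ) → ℕ
∑ {zero}  f = 0
∑ {suc n} f = f fzero + ∑ (λ i → f (fsuc i))

_≤ᵖ_ : ∀ {n} → (Fin n → ℕ) → (Fin n → ℕ) → Set
f ≤ᵖ g = ∀ i → f i ≤ g i

∑-mono : ∀ {n} {f g : Fin n → ℕ} → f ≤ᵖ g → ∑ f ≤ ∑ g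
∑-mono {zero}  f≤g = z≤n
∑-mono {suc n} f≤g = +-mono-≤ (f≤g fzero) (∑-mono (λ i → f≤g (fsuc i)))

∑-mono-< : ∀ {n} {f g : Fin n → ℕ} → f ≤ᵖ g → ∀ w → f w < g w → ∑ f < ∑ g
∑-mono-< {suc n} f≤g fzero    f<g = +-mono-<-≤ f<g (∑-mono (λ i → f≤g (fsuc i)))
∑-mono-< {suc n} f≤g (fsuc w) f<g =
  +-mono-≤-< (f≤g fzero) (∑-mono-< (λ i → f≤g (fsuc i)) w f<g)

term≤∑ : ∀ {n} (f : Fin n → ℕ) w → f w ≤ ∑ f
term≤∑ f fzero    = m≤m+n _ _
term≤∑ f (fsuc w) = ≤-trans (term≤∑ (λ i → f (fsuc i)) w) (m≤n+m _ (f fzero))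

∑-*ˡ : ∀ {n} b (f : Fin n → ℕ) → ∑ (λ i → b * f i) ≡ b * ∑ f
∑-*ˡ {zero}  b f = ≡-sym (*-zeroʳ b)
∑-*ˡ {suc n} b f = trans (cong (b * f fzero +_) (∑-*ˡ b (λ i → f (fsuc i))))
                         (≡-sym (*-distribˡ-+ b (f fzero) _))

ind-∈ : ∀ {n} {S : Subset n} {v} → v ∈ S → ind S v ≡ 1
ind-∈ v∈S rewrite []=⇒lookup v∈S = refl

ind-∉ : ∀ {n} {S : Subset n} {v} → v ∉ S → ind S v ≡ 0
ind-∉ {S = S} {v} v∉S with lookup S v in eq
... | true  = contradiction (lookup⇒[]= v S eq) v∉S
... | false = refl

∣p∣≡∑ind : ∀ {n} (p : Subset n) → ∣ p ∣ ≡ ∑ (ind p)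
∣p∣≡∑ind []          = refl
∣p∣≡∑ind (true ∷ p)  = cong suc (∣p∣≡∑ind p)
∣p∣≡∑ind (false ∷ p) = ∣p∣≡∑ind p

adj⇒∈nbhd : ∀ {n} (G : Graph n) {v w} → adj G v w ≡ true → w ∈ nbhd G v
adj⇒∈nbhd G {v} {w} vw = lookup⇒[]= w _ (trans (lookup∘tabulate (adj G v) w) vw)

foldr⊔-upper : ∀ {A : Set} (g : A → ℕ) {xs : List A} {a} → a List.∈ xs →
               g a ≤ foldr _⊔_ 0 (map g xs)
foldr⊔-upper g (here refl) = m≤m⊔n _ _
foldr⊔-upper g (there a∈xs) = ≤-trans (foldr⊔-upper g a∈xs) (m≤n⊔m _ _)

degree≤maxDegree : ∀ {n} (G : Graph n) v → degree G v ≤ maxDegree G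
degree≤maxDegree G v = foldr⊔-upper (degree G) (∈-allFin v)

insert-⊆ : ∀ {n} {X V : Subset n} {u} → u ∈ V → X ⊆ V → ⁅ u ⁆ ∪ X ⊆ V
insert-⊆ {X = X} {u = u} u∈V X⊆V v∈ with x∈p∪q⁻ ⁅ u ⁆ X v∈
... | inj₁ v∈u rewrite x∈⁅y⁆⇒x≡y u v∈u = u∈V
... | inj₂ v∈X = X⊆V v∈X

module _ {n : ℕ} (G : Graph n) where

  DominatedBy : Subset n → Fin n → Set
  DominatedBy X v = v ∈ X ⊎ ∃[ w ] (w ∈ X × adj G v w ≡ true)

  Dominates : Subset n → Subset n → Set
  Dominates V X = ∀ {v} → v ∈ V → DominatedBy X v

  dominatedBy? : ∀ X v → Dec (DominatedBy X v)
  dominatedBy? X v = (v ∈? X) ⊎-dec any? (λ w → (w ∈? X) ×-dec (adj G v w Bool.≟ true))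

  dominatedBy-mono : ∀ {X Y v} → X ⊆ Y → DominatedBy X v → DominatedBy Y v
  dominatedBy-mono X⊆Y (inj₁ v∈X)          = inj₁ (X⊆Y v∈X)
  dominatedBy-mono X⊆Y (inj₂ (w , w∈X , vw)) = inj₂ (w , X⊆Y w∈X , vw)

  dominates-nonempty : ∀ {V X} → Nonempty V → Dominates V X → Nonempty X
  dominates-nonempty (v , v∈V) dom with dom v∈V
  ... | inj₁ v∈X          = v , v∈X
  ... | inj₂ (w , w∈X , _) = w , w∈X

  undominated⇒nonadjacent : ∀ {X u w} → ¬ DominatedBy X u → w ∈ X → adj G u w ≡ false
  undominated⇒nonadjacent {u = u} {w} ¬dom w∈X with adj G u w in uw
  ... | true  = contradiction (inj₂ (w , w∈X , uw)) ¬dom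
  ... | false = refl

  independent-insert : ∀ {X u} → Independent G X → (∀ w → w ∈ X → adj G u w ≡ false) →
                       Independent G (⁅ u ⁆ ∪ X)
  independent-insert {X} {u} indX u≁X v w v∈ w∈
    with x∈p∪q⁻ ⁅ u ⁆ X v∈ | x∈p∪q⁻ ⁅ u ⁆ X w∈
  ... | inj₁ v∈u | inj₁ w∈u rewrite x∈⁅y⁆⇒x≡y u v∈u | x∈⁅y⁆⇒x≡y u w∈u = irref G u
  ... | inj₁ v∈u | inj₂ w∈X rewrite x∈⁅y⁆⇒x≡y u v∈u = u≁X w w∈X
  ... | inj₂ v∈X | inj₁ w∈u rewrite x∈⁅y⁆⇒x≡y u w∈u = trans (sym G v u) (u≁X v v∈X)
  ... | inj₂ v∈X | inj₂ w∈X = indX v w v∈X w∈X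

  greedy : (V : Subset n) (L : List (Fin n)) →
           Σ[ X ∈ Subset n ] (X ⊆ V × Independent G X ×
                              (∀ {v} → v List.∈ L → v ∈ V → DominatedBy X v))
  greedy V [] = ∅ , ⊥⊆ , (λ u _ u∈∅ → contradiction u∈∅ ∉⊥) , (λ ())
  greedy V (u ∷ L) with greedy V L
  ... | X , X⊆V , indX , domL with u ∈? V | dominatedBy? X u
  ... | no u∉V | _ = X , X⊆V , indX , dom
    where
    dom : ∀ {v} → v List.∈ u ∷ L → v ∈ V → DominatedBy X v
    dom (here refl)  u∈V = contradiction u∈V u∉V
    dom (there v∈L) v∈V = domL v∈L v∈V
  ... | yes _ | yes domU = X , X⊆V , indX , dom
    where
    dom : ∀ {v} → v List.∈ u ∷ L → v ∈ V → DominatedBy X v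
    dom (here refl)  _   = domU
    dom (there v∈L) v∈V = domL v∈L v∈V
  ... | yes u∈V | no ¬domU =
    ⁅ u ⁆ ∪ X , insert-⊆ u∈V X⊆V ,
    independent-insert indX (λ w → undominated⇒nonadjacent ¬domU) , dom
    where
    dom : ∀ {v} → v List.∈ u ∷ L → v ∈ V → DominatedBy (⁅ u ⁆ ∪ X) v
    dom (here refl)  _   = inj₁ (x∈p∪q⁺ (inj₁ (x∈⁅x⁆ u)))
    dom (there v∈L) v∈V = dominatedBy-mono (q⊆p∪q ⁅ u ⁆ X) (domL v∈L v∈V)

  dominatingIndependent : (V : Subset n) →
                          Σ[ X ∈ Subset n ] (X ⊆ V × Independent G X × Dominates V X)
  dominatingIndependent V with greedy V (allFin n)
  ... | X , X⊆V , indX , dom = X , X⊆V , indX , λ {v} → dom (∈-allFin v)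

module Strategy {n : ℕ} (G : Graph n) (b : ℕ) where

  Δ : ℕ
  Δ = maxDegree G

  k : ℕ
  k = b + b * Δ

  seen : (Fin n → ℕ) → Fin n → ℕ
  seen x v = x v + ∑ (λ u → ind (nbhd G v) u * x u)

  nbrs-mono : ∀ {x y} → x ≤ᵖ y → ∀ v → (λ u → ind (nbhd G v) u * x u) ≤ᵖ (λ u → ind (nbhd G v) u * y u)
  nbrs-mono x≤y v u = *-monoʳ-≤ (ind (nbhd G v) u) (x≤y u)

  seen-mono : ∀ {x y} → x ≤ᵖ y → ∀ v → seen x v ≤ seen y v
  seen-mono x≤y v = +-mono-≤ (x≤y v) (∑-mono (nbrs-mono x≤y v))

  seen-grows-self : ∀ {x y} → x ≤ᵖ y → ∀ v → x v < y v → seen x v < seen y v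
  seen-grows-self x≤y v x<y = +-mono-<-≤ x<y (∑-mono (nbrs-mono x≤y v))

  seen-grows-nbr : ∀ {x y} → x ≤ᵖ y → ∀ {v w} → adj G v w ≡ true → x w < y w →
                   seen x v < seen y v
  seen-grows-nbr {x} {y} x≤y {v} {w} vw x<y =
    +-mono-≤-< (x≤y v) (∑-mono-< (nbrs-mono x≤y v) w weighted)
    where
    weighted : ind (nbhd G v) w * x w < ind (nbhd G v) w * y w
    weighted rewrite ind-∈ (adj⇒∈nbhd G vw) | *-identityˡ (x w) | *-identityˡ (y w) = x<y

  Capped : (Fin n → ℕ) → Set
  Capped x = ∀ v → x v ≤ b

  -- If nobody has more than b colours, v sees at most b·Δ of them on its
  -- neighbours; so having seen k colours forces b colours on v itself.
  saturated : ∀ {x} → Capped x → ∀ v → k ≤ seen x v → b ≤ x v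
  saturated {x} capped v k≤seen =
    +-cancelʳ-≤ (b * Δ) b (x v) (≤-trans k≤seen (+-monoʳ-≤ (x v) nbr≤bΔ))
    where
    open ≤-Reasoning
    N : Subset n
    N = nbhd G v
    nbr≤bΔ : ∑ (λ u → ind N u * x u) ≤ b * Δ
    nbr≤bΔ = begin
      ∑ (λ u → ind N u * x u) ≤⟨ ∑-mono (λ u → ≤-trans (*-monoʳ-≤ (ind N u) (capped u))
                                                        (≤-reflexive (*-comm (ind N u) b))) ⟩
      ∑ (λ u → b * ind N u)   ≡⟨ ∑-*ˡ b (ind N) ⟩
      b * ∑ (ind N)           ≡⟨ cong (b *_) (≡-sym (∣p∣≡∑ind N)) ⟩
      b * degree G v          ≤⟨ *-monoʳ-≤ b (degree≤maxDegree G v) ⟩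
      b * Δ                   ∎

  -- total number of colours still owed; it bounds the remaining rounds
  deficit : (Fin n → ℕ) → ℕ
  deficit x = ∑ (λ v → b ∸ x v)

  deficit-positive : ∀ {x} v → x v < b → 0 < deficit x
  deficit-positive {x} v x<b = ≤-trans (m<n⇒0<n∸m x<b) (term≤∑ (λ u → b ∸ x u) v)

  deficit-decreases : ∀ {x y} → x ≤ᵖ y → ∀ w → x w < y w → y w ≤ b → deficit y < deficit x
  deficit-decreases x≤y w x<y y≤b =
    ∑-mono-< (λ u → ∸-monoʳ-≤ b (x≤y u)) w (∸-monoʳ-< x<y y≤b)

  record Invariant (l x : Fin n → ℕ) : Set where
    field
      capped  : Capped x
      tracked : ∀ v → l v ≤ seen x v

  initial : Invariant (λ _ → 0) (λ _ → 0)
  initial = record { capped = λ _ → z≤n ; tracked = λ _ → z≤n }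

  record Response (l x : Fin n → ℕ) (V : Subset n) : Set where
    field
      X           : Subset n
      X⊆V         : X ⊆ V
      independent : Independent G X
      safe        : ∀ v → k ≤ l v + ind V v → b ≤ x v + ind X v
      invariant   : Invariant (λ v → l v + ind V v) (λ v → x v + ind X v)
      progress    : deficit (λ v → x v + ind X v) < deficit x

  respond : ∀ {l x} → Invariant l x → (V : Subset n) → Nonempty V →
            (∀ v → v ∈ V → x v < b) → Response l x V
  respond {l} {x} inv V V≢∅ needy with dominatingIndependent G V
  ... | X , X⊆V , indX , dom = record
    { X = X ; X⊆V = X⊆V ; independent = indX
    ; safe = λ v k≤l' → saturated capped' v (≤-trans k≤l' (tracked' v))
    ; invariant = record { capped = capped' ; tracked = tracked' }
    ; progress = progress
    }
    where
    open Invariant inv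
    open ≤-Reasoning

    x' : Fin n → ℕ
    x' v = x v + ind X v

    x≤x' : x ≤ᵖ x'
    x≤x' v = m≤m+n (x v) _

    coloured : ∀ {w} → w ∈ X → x' w ≡ suc (x w)
    coloured {w} w∈X = trans (cong (x w +_) (ind-∈ w∈X)) (+-comm (x w) 1)

    uncoloured : ∀ {w} → w ∉ X → x' w ≡ x w
    uncoloured {w} w∉X = trans (cong (x w +_) (ind-∉ w∉X)) (+-identityʳ (x w))

    x<x' : ∀ {w} → w ∈ X → x w < x' w
    x<x' w∈X = ≤-reflexive (≡-sym (coloured w∈X))

    capped' : Capped x'
    capped' v with v ∈? X
    ... | yes v∈X = ≤-trans (≤-reflexive (coloured v∈X)) (needy v (X⊆V v∈X))
    ... | no  v∉X = ≤-trans (≤-reflexive (uncoloured v∉X)) (capped v)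

    seen-grows : ∀ {v} → v ∈ V → seen x v < seen x' v
    seen-grows {v} v∈V with dom v∈V
    ... | inj₁ v∈X            = seen-grows-self x≤x' v (x<x' v∈X)
    ... | inj₂ (w , w∈X , vw) = seen-grows-nbr x≤x' vw (x<x' w∈X)

    tracked' : ∀ v → l v + ind V v ≤ seen x' v
    tracked' v with v ∈? V
    ... | yes v∈V = begin
      l v + ind V v  ≡⟨ cong (l v +_) (ind-∈ v∈V) ⟩
      l v + 1        ≡⟨ +-comm (l v) 1 ⟩
      suc (l v)      ≤⟨ s≤s (tracked v) ⟩
      suc (seen x v) ≤⟨ seen-grows v∈V ⟩
      seen x' v      ∎
    ... | no v∉V = begin
      l v + ind V v  ≡⟨ cong (l v +_) (ind-∉ v∉V) ⟩
      l v + 0        ≡⟨ +-identityʳ (l v) ⟩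
      l v            ≤⟨ tracked v ⟩
      seen x v       ≤⟨ seen-mono x≤x' v ⟩
      seen x' v      ∎

    progress : deficit x' < deficit x
    progress with dominates-nonempty G V≢∅ dom
    ... | w , w∈X = deficit-decreases x≤x' w (x<x' w∈X) (capped' w)

  painterWins : ∀ m {l x} → deficit x ≤ m → Invariant l x → PainterWins G b k l x
  painterWins zero {x = x} d≤0 inv = step λ V (v , v∈V) needy →
    contradiction (≤-trans (deficit-positive {x} v (needy v v∈V)) d≤0) n≮0
  painterWins (suc m) d≤m inv = step λ V V≢∅ needy →
    let open Response (respond inv V V≢∅ needy)
    in X , X⊆V , independent , safe , painterWins m (≤-pred (≤-trans progress d≤m)) invariant

  k≤2bΔ : 1 ≤ Δ → k ≤ 2 * b * Δ
  k≤2bΔ 1≤Δ = begin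
    b + b * Δ     ≤⟨ +-monoˡ-≤ (b * Δ) (≤-trans (≤-reflexive (≡-sym (*-identityʳ b))) (*-monoʳ-≤ b 1≤Δ)) ⟩
    b * Δ + b * Δ ≡⟨ cong (b * Δ +_) (≡-sym (+-identityʳ (b * Δ))) ⟩
    2 * (b * Δ)   ≡⟨ ≡-sym (*-assoc 2 b Δ) ⟩
    2 * b * Δ     ∎
    where open ≤-Reasoning

corollary1 : Σ ℕ λ c → ∀ (n : ℕ) (G : Graph n) (b : ℕ) → 1 ≤ b → 1 ≤ maxDegree G →
    Σ ℕ λ k → k ≤ c * b * maxDegree G × Paintable b k G
corollary1 = 2 , λ n G b _ 1≤Δ →
  let open Strategy G b
  in k , k≤2bΔ 1≤Δ , painterWins (deficit (λ _ → 0)) ≤-refl initial
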